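{- If $G$ is a trigraph and $\varphi\in\operatorname{Aut}(G)$, then there exists a partial contraction sequence of $G$ of width at most $4\Delta(G)$ whose final partition is the partition of $V(G)$ into $\langle\varphi\rangle$-orbits (i.e., which contracts $G$ to $G/\langle\varphi\rangle$). In particular, $\operatorname{tww}(G)\leq\max\{4\Delta(G),\operatorname{tww}(G/\langle\varphi\rangle)\}$.
   Context: A trigraph is a finite simple graph whose edges are colored red or black; $\Delta(G)$ is the maximum degree (both colors counted). $\operatorname{Aut}(G)$ denotes the automorphism group of the underlying uncolored graph. For a partition $\mathcal{P}$ of $V(G)$, the quotient trigraph $G/\mathcal{P}$ has vertex set $\mathcal{P}$; two parts $U,W$ are joined by a black edge if every pair $u\in U,w\in W$ is a black edge, are non-adjacent if no such pair is an edge, and are joined by a red edge otherwise. For a group $\Gamma\subseteq\operatorname{Aut}(G)$, $G/\Gamma$ is the quotient by the partition into $\Gamma$-orbits. A partial contraction sequence of an $n$-vertex trigraph $G$ is a sequence $\mathcal{P}_n,\dots,\mathcal{P}_i$ of partitions with $\mathcal{P}_n$ discrete and each $\mathcal{P}_j$ obtained from $\mathcal{P}_{j+1}$ by merging two parts; its width is the maximum red degree over all $G/\mathcal{P}_j$ in the sequence. A (full) contraction sequence ends with $\mathcal{P}_1$, and $\operatorname{tww}(G)$ is the minimum width of a full contraction sequence. -}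

module Defs where

open import Data.Nat using (ℕ; zero; suc; _≤_; _⊔_)
open import Data.Fin using (Fin; _≟_)
open import Data.Fin.Permutation using (Permutation′; _⟨$⟩ʳ_)
open import Data.List using (List; length; foldr; map; lookup)
open import Data.List.Base using (filterᵇ)
open import Data.Bool.ListAction using (all; any)
open import Data.List.Base using (allFin)
open import Data.Bool using (Bool; true; false; not; _∧_; _∨_; if_then_else_; T)
open import Data.Product using (Σ; ∃; ∃-syntax; _×_; _,_)
open import Data.Sum using (_⊎_)
open import Relation.Nullary using (¬_)
open import Relation.Nullary.Decidable using (⌊_⌋; Dec; yes; no)
open import Relation.Binary.PropositionalEquality using (_≡_; _≢_)
open import Function.Bundles using (_⇔_)

data Color : Set where
  none black red : Color

_==c_ : Color → Color → Bool
none  ==c none  = true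
black ==c black = true
red   ==c red   = true
_     ==c _     = false

_==f_ : ∀ {n} → Fin n → Fin n → Bool
a ==f b = ⌊ a ≟ b ⌋

Trigraph : ℕ → Set
Trigraph n = Fin n → Fin n → Color

IsTrigraph : ∀ {n} → Trigraph n → Set
IsTrigraph {n} G = (∀ (x y : Fin n) → G x y ≡ G y x) × (∀ (x : Fin n) → G x x ≡ none)

Adj : ∀ {n} → Trigraph n → Fin n → Fin n → Set
Adj G x y = ¬ (G x y ≡ none)

deg : ∀ {n} → Trigraph n → Fin n → ℕ
deg {n} G x = length (filterᵇ (λ y → not (G x y ==c none)) (allFin n))

Δ : ∀ {n} → Trigraph n → ℕ
Δ {n} G = foldr _⊔_ 0 (map (deg G) (allFin n))

IsAut : ∀ {n} → Trigraph n → Permutation′ n → Set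
IsAut {n} G φ = ∀ (x y : Fin n) → Adj G x y ⇔ Adj G (φ ⟨$⟩ʳ x) (φ ⟨$⟩ʳ y)

-- A partition of Fin n is represented by a labelling; parts are the
-- nonempty fibres.  Two vertices are in the same part iff equal labels.
Labeling : ℕ → Set
Labeling n = Fin n → Fin n

inImage : ∀ {n} → Labeling n → Fin n → Bool
inImage {n} P a = any (λ x → P x ==f a) (allFin n)

-- Colour between the parts with labels a and b in G/P
-- (a ≠ b, both parts nonempty): black if all pairs are black edges,
-- none if no pair is an edge, red otherwise.  No loops.
quotColor : ∀ {n} → Trigraph n → Labeling n → Fin n → Fin n → Color
quotColor {n} G P a b =
  if a ==f b then none else
  (if all (λ u → all (λ w → not (P u ==f a) ∨ not (P w ==f b) ∨ (G u w ==c black)) (allFin n)) (allFin n)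
   then black
   else (if all (λ u → all (λ w → not (P u ==f a) ∨ not (P w ==f b) ∨ (G u w ==c none)) (allFin n)) (allFin n)
         then none
         else red))

redDeg : ∀ {n} → Trigraph n → Labeling n → Fin n → ℕ
redDeg {n} G P a = length (filterᵇ (λ b → inImage P b ∧ (quotColor G P a b ==c red)) (allFin n))

RedDegAtMost : ∀ {n} → ℕ → Trigraph n → Labeling n → Set
RedDegAtMost {n} k G P = ∀ (x : Fin n) → redDeg G P (P x) ≤ k

Discrete : ∀ {n} → Labeling n → Set
Discrete {n} P = ∀ (x y : Fin n) → P x ≡ P y → x ≡ y

SinglePart : ∀ {n} → Labeling n → Set
SinglePart {n} P = ∀ (x y : Fin n) → P x ≡ P y

MergeStep : ∀ {n} → Labeling n → Labeling n → Set
MergeStep {n} P Q = Σ (Fin n) λ u → Σ (Fin n) λ v → (P u ≢ P v) ×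
  (∀ (x y : Fin n) → (Q x ≡ Q y) ⇔
     (P x ≡ P y ⊎ (P x ≡ P u × P y ≡ P v) ⊎ (P x ≡ P v × P y ≡ P u)))

data PCS {n} (G : Trigraph n) (k : ℕ) : Labeling n → Set where
  start : ∀ {P} → Discrete P → RedDegAtMost k G P → PCS G k P
  step  : ∀ {P Q} → PCS G k P → MergeStep P Q → RedDegAtMost k G Q → PCS G k Q

TwwAtMost : ∀ {n} → Trigraph n → ℕ → Set
TwwAtMost {n} G k = Σ (Labeling n) λ P → PCS G k P × SinglePart P

iter : ∀ {n} → Permutation′ n → ℕ → Fin n → Fin n
iter φ zero x = x
iter φ (suc k) x = φ ⟨$⟩ʳ iter φ k x

IsOrbitPartition : ∀ {n} → Permutation′ n → Labeling n → Set
IsOrbitPartition {n} φ P = ∀ (x y : Fin n) → (P x ≡ P y) ⇔ (∃[ k ] iter φ k x ≡ y)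

-- The quotient trigraph G/P on its parts, enumerated as Fin m
-- (parts listed by increasing label).
partLabels : ∀ {n} → Labeling n → List (Fin n)
partLabels {n} P = filterᵇ (λ a → inImage P a) (allFin n)

numParts : ∀ {n} → Labeling n → ℕ
numParts P = length (partLabels P)

quotient : ∀ {n} → Trigraph n → (P : Labeling n) → Trigraph (numParts P)
quotient G P i j = quotColor G P (lookup (partLabels P) i) (lookup (partLabels P) j)

{-# OPTIONS --safe #-}

-- Cut every cycle of φ at a canonical representative, so that each vertex x has a position
-- index x < period x on its cycle, and call two vertices level-k equivalent when they lie on
-- the same cycle and their positions agree after division by 2^k. Level 0 is the discrete
-- partition and level n the orbit partition. From level k to level k + 1 parts are merged one
-- pair at a time, and every partition in between has red degree at most 4Δ(G): a red edge
-- leaving the part of x leaves its level-(k + 1) block, and translating it back along the cycle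
-- gives a neighbour w of the start of that block whose next 2^(k + 1) iterates meet at most
-- four level-k blocks. A contraction sequence of G/⟨φ⟩ then lifts part by part to one of G
-- that continues from the orbit partition.

module Submission where

open import Defs
open import Data.Nat using (ℕ; zero; suc; _+_; _*_; _∸_; _^_; _≤_; _<_; z≤n; s≤s; _⊔_; NonZero; _<?_)
open import Data.Nat.Properties hiding (_≟_)
open import Data.Nat.Properties using () renaming (_≟_ to _≟ℕ_)
open import Data.Nat.DivMod
open import Data.Nat.Tactic.RingSolver using (solve-∀)
open import Data.Fin using (Fin; zero; suc; toℕ; _≟_)
open import Data.Fin.Patterns using (0F; 1F; 2F; 3F)
open import Data.Fin.Properties using (pigeonhole; toℕ<n; toℕ-injective; any?; ¬∀⟶∃¬; injective⇒≤)
open import Data.Fin.Permutation using (Permutation′; _⟨$⟩ʳ_; _⟨$⟩ˡ_; inverseˡ; inverseʳ)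
open import Data.Bool using (Bool; true; false; not; _∧_; _∨_; T; if_then_else_)
open import Data.Bool.Properties using (T-≡; T-∧; ⇔→≡)
open import Data.Bool.ListAction using (all; any)
open import Data.List using (List; []; _∷_; _++_; length; allFin; filterᵇ; lookup; foldr; map; cartesianProduct; cartesianProductWith)
open import Data.List.Properties using (length-++; length-map)
open import Data.List.Membership.Propositional using (_∈_; lose)
open import Data.List.Membership.Propositional.Properties
  using (∈-allFin; ∈-filter⁺; ∈-filter⁻; ∈-lookup; ∈-map⁺; ∈-cartesianProduct⁺; ∈-cartesianProductWith⁺)
open import Data.List.Relation.Unary.All as All using (All)
open import Data.List.Relation.Unary.All.Properties using (all⁺; all⁻; tabulate⁺)
open import Data.List.Relation.Unary.Any as Any using (Any; here; there)
open import Data.List.Relation.Unary.Any.Properties using (any⁺; any⁻; lookup-index)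
open import Data.List.Relation.Unary.AllPairs.Core using (_∷_)
open import Data.List.Relation.Unary.Unique.Propositional using (Unique)
open import Data.List.Relation.Unary.Unique.Propositional.Properties using (allFin⁺; filter⁺)
open import Data.Product using (Σ; Σ-syntax; ∃-syntax; _×_; _,_; proj₁; proj₂)
open import Data.Product.Properties using (,-injectiveˡ; ,-injectiveʳ; ≡-dec)
open import Data.Product.Function.NonDependent.Propositional using (_×-⇔_)
open import Data.Sum using (_⊎_; inj₁; inj₂)
open import Data.Sum.Function.Propositional using (_⊎-⇔_)
open import Function using (id; _∘_)
open import Function.Bundles using (_⇔_; mk⇔; Equivalence)
import Function.Properties.Equivalence as ⇔
open import Level using (0ℓ)
open import Relation.Nullary using (¬_; Dec; yes; no; does; contradiction)
open import Relation.Nullary.Decidable using (_×-dec_; map′; dec-true; dec-false; T?; toWitness; fromWitness)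
open import Relation.Unary using (Pred; Decidable)
open import Relation.Binary.Definitions using (DecidableEquality; tri<; tri≈; tri>)
open import Relation.Binary.PropositionalEquality

open Equivalence using (to; from)

-- Least witnesses

record Least (P : Pred ℕ 0ℓ) : Set where
  constructor least-is
  field
    value   : ℕ
    holds   : P value
    minimal : ∀ {k} → k < value → ¬ P k

open Least

module _ {P : Pred ℕ 0ℓ} (P? : Decidable P) where

  private
    search : ∀ b → (∀ {k} → k < b → ¬ P k) ⊎ Least P
    search zero = inj₁ (λ ())
    search (suc b) with search b
    ... | inj₂ l = inj₂ l
    ... | inj₁ nothing<b with P? b
    ...   | yes p = inj₂ (least-is b p nothing<b)
    ...   | no ¬p = inj₁ λ k<1+b → case-< (m<1+n⇒m<n∨m≡n k<1+b)
      where
      case-< : ∀ {k} → k < b ⊎ k ≡ b → ¬ P k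
      case-< (inj₁ k<b) = nothing<b k<b
      case-< (inj₂ refl) = ¬p

  least : ∀ {k} → P k → Least P
  least {k} p with search (suc k)
  ... | inj₂ l = l
  ... | inj₁ nothing = contradiction p (nothing ≤-refl)

least-≤ : ∀ {P : Pred ℕ 0ℓ} (l : Least P) {k} → P k → value l ≤ k
least-≤ l p = ≮⇒≥ λ k<v → minimal l k<v p

least-unique : ∀ {P Q : Pred ℕ 0ℓ} (l : Least P) (l′ : Least Q) →
               (∀ {k} → P k → Q k) → (∀ {k} → Q k → P k) → value l ≡ value l′
least-unique l l′ P⇒Q Q⇒P =
  ≤-antisym (least-≤ l (Q⇒P (holds l′))) (least-≤ l′ (P⇒Q (holds l)))

-- Cycles of a permutation

module Iterates {n} (φ : Permutation′ n) where
  open ≡-Reasoning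

  iter-+ : ∀ a b x → iter φ (a + b) x ≡ iter φ a (iter φ b x)
  iter-+ zero    b x = refl
  iter-+ (suc a) b x = cong (φ ⟨$⟩ʳ_) (iter-+ a b x)

  iter-comm : ∀ a b x → iter φ a (iter φ b x) ≡ iter φ b (iter φ a x)
  iter-comm a b x = begin
    iter φ a (iter φ b x) ≡⟨ iter-+ a b x ⟨
    iter φ (a + b) x      ≡⟨ cong (λ c → iter φ c x) (+-comm a b) ⟩
    iter φ (b + a) x      ≡⟨ iter-+ b a x ⟩
    iter φ b (iter φ a x) ∎

  iter-injective : ∀ a {x y} → iter φ a x ≡ iter φ a y → x ≡ y
  iter-injective zero    eq = eq
  iter-injective (suc a) {x} {y} eq = iter-injective a (begin
    iter φ a x                         ≡⟨ inverseˡ φ ⟨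
    φ ⟨$⟩ˡ (φ ⟨$⟩ʳ iter φ a x)          ≡⟨ cong (φ ⟨$⟩ˡ_) eq ⟩
    φ ⟨$⟩ˡ (φ ⟨$⟩ʳ iter φ a y)          ≡⟨ inverseˡ φ ⟩
    iter φ a y                         ∎)

  iterˡ : ℕ → Fin n → Fin n
  iterˡ zero    x = x
  iterˡ (suc t) x = iterˡ t (φ ⟨$⟩ˡ x)

  iter-iterˡ : ∀ t x → iter φ t (iterˡ t x) ≡ x
  iter-iterˡ zero    x = refl
  iter-iterˡ (suc t) x = trans (cong (φ ⟨$⟩ʳ_) (iter-iterˡ t (φ ⟨$⟩ˡ x))) (inverseʳ φ)

  iter-*-fixed : ∀ k {p x} → iter φ p x ≡ x → iter φ (k * p) x ≡ x
  iter-*-fixed zero    fix = refl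
  iter-*-fixed (suc k) {p} {x} fix =
    trans (iter-+ p (k * p) x) (trans (cong (iter φ p) (iter-*-fixed k fix)) fix)

  iter-returns : ∀ x → ∃[ p ] suc p ≤ n × iter φ (suc p) x ≡ x
  iter-returns x with pigeonhole ≤-refl (λ (t : Fin (suc n)) → iter φ (toℕ t) x)
  ... | i , j , i<j , same with m≤n⇒∃[o]m+o≡n i<j
  ...   | d , 1+i+d≡j = d , ≤-trans (s≤s (m≤n+m d (toℕ i))) (≤-trans (≤-reflexive 1+i+d≡j) (≤-pred (toℕ<n j))) ,
    iter-injective (toℕ i) (begin
      iter φ (toℕ i) (iter φ (suc d) x) ≡⟨ iter-+ (toℕ i) (suc d) x ⟨
      iter φ (toℕ i + suc d) x          ≡⟨ cong (λ c → iter φ c x) (trans (+-suc (toℕ i) d) 1+i+d≡j) ⟩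
      iter φ (toℕ j) x                  ≡⟨ same ⟨
      iter φ (toℕ i) x                  ∎)

  Returns : Fin n → Pred ℕ 0ℓ
  Returns x k = iter φ (suc k) x ≡ x

  -- Abstract, so that conversion checking never unfolds the searches (prohibitively slow).
  abstract
    period-search : (x : Fin n) → Least (Returns x)
    period-search x = least {P = Returns x} (λ k → iter φ (suc k) x ≟ x)
                            {proj₁ (iter-returns x)} (proj₂ (proj₂ (iter-returns x)))

  period : Fin n → ℕ
  period x = suc (value (period-search x))

  iter-period : ∀ x → iter φ (period x) x ≡ x
  iter-period x = holds (period-search x)

  period≤n : ∀ x → period x ≤ n
  period≤n x = ≤-trans (s≤s (least-≤ (period-search x) (proj₂ (proj₂ (iter-returns x)))))
                       (proj₁ (proj₂ (iter-returns x)))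

  period-iter : ∀ t x → period (iter φ t x) ≡ period x
  period-iter t x = cong suc (least-unique (period-search (iter φ t x)) (period-search x)
    (λ {k} ret → iter-injective t (trans (iter-comm t (suc k) x) ret))
    (λ {k} ret → trans (iter-comm (suc k) t x) (cong (iter φ t) ret)))

  iter-mod-period : ∀ t x → iter φ (t % period x) x ≡ iter φ t x
  iter-mod-period t x = begin
    iter φ (t % L) x                          ≡⟨ cong (iter φ (t % L)) (iter-*-fixed (t / L) (iter-period x)) ⟨
    iter φ (t % L) (iter φ (t / L * L) x)     ≡⟨ iter-+ (t % L) (t / L * L) x ⟨
    iter φ (t % L + t / L * L) x              ≡⟨ cong (λ c → iter φ c x) (m≡m%n+[m/n]*n t L) ⟨
    iter φ t x                                ∎
    where
    L : ℕ
    L = period x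

  period-minimal : ∀ {d x} → suc d < period x → iter φ (suc d) x ≢ x
  period-minimal {x = x} d<L = minimal (period-search x) (≤-pred d<L)

  period-gap : ∀ {a b x} → a < b → b < period x → iter φ a x ≢ iter φ b x
  period-gap {a} {b} {x} a<b b<L same with m≤n⇒∃[o]m+o≡n a<b
  ... | d , 1+a+d≡b = period-minimal (≤-<-trans (≤-trans (m≤n+m (suc d) a) (≤-reflexive a+1+d≡b)) b<L)
        (iter-injective a (begin
          iter φ a (iter φ (suc d) x) ≡⟨ iter-+ a (suc d) x ⟨
          iter φ (a + suc d) x        ≡⟨ cong (λ c → iter φ c x) a+1+d≡b ⟩
          iter φ b x                  ≡⟨ same ⟨
          iter φ a x                  ∎))
    where
    a+1+d≡b : a + suc d ≡ b
    a+1+d≡b = trans (+-suc a d) 1+a+d≡b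

  iter-<period-injective : ∀ {a b} x → a < period x → b < period x → iter φ a x ≡ iter φ b x → a ≡ b
  iter-<period-injective {a} {b} x a<L b<L same with <-cmp a b
  ... | tri≈ _ a≡b _ = a≡b
  ... | tri< a<b _ _ = contradiction same (period-gap a<b b<L)
  ... | tri> _ _ b<a = contradiction (sym same) (period-gap b<a a<L)

  infix 4 _↝_
  _↝_ : Fin n → Fin n → Set
  x ↝ y = ∃[ k ] iter φ k x ≡ y

  ↝-trans : ∀ {x y z} → x ↝ y → y ↝ z → x ↝ z
  ↝-trans {x} (a , refl) (b , refl) = b + a , iter-+ b a x

  ↝-sym : ∀ {x y} → x ↝ y → y ↝ x
  ↝-sym {x} (k , refl) = k * p , (begin
    iter φ (k * p) (iter φ k x) ≡⟨ iter-+ (k * p) k x ⟨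
    iter φ (k * p + k) x        ≡⟨ cong (λ c → iter φ c x) (trans (+-comm (k * p) k) (sym (*-suc k p))) ⟩
    iter φ (k * period x) x     ≡⟨ iter-*-fixed k (iter-period x) ⟩
    x                           ∎)
    where
    p : ℕ
    p = value (period-search x)

  iter-↝ : ∀ t x → x ↝ iter φ t x
  iter-↝ t x = t , refl

  ↝-bounded : ∀ {x y} → x ↝ y → ∃[ k ] k < period x × iter φ k x ≡ y
  ↝-bounded {x} (k , refl) = k % period x , m%n<n k (period x) , iter-mod-period k x

  _↝?_ : ∀ x y → Dec (x ↝ y)
  x ↝? y = map′ (λ (k , _ , eq) → k , eq) ↝-bounded (anyUpTo? (λ k → iter φ k x ≟ y) (period x))

  RepresentedBy : Fin n → Pred ℕ 0ℓ
  RepresentedBy x k = ∃[ v ] toℕ v ≡ k × x ↝ v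

  abstract
    rep-search : (x : Fin n) → Least (RepresentedBy x)
    rep-search x = least (λ k → any? λ v → (toℕ v ≟ℕ k) ×-dec (x ↝? v)) (x , refl , 0 , refl)

  rep : Fin n → Fin n
  rep x = proj₁ (holds (rep-search x))

  ↝-rep : ∀ x → x ↝ rep x
  ↝-rep x = proj₂ (proj₂ (holds (rep-search x)))

  rep-cong : ∀ {x y} → x ↝ y → rep x ≡ rep y
  rep-cong {x} {y} x↝y = toℕ-injective (begin
    toℕ (rep x)                  ≡⟨ proj₁ (proj₂ (holds (rep-search x))) ⟩
    value (rep-search x)         ≡⟨ least-unique (rep-search x) (rep-search y)
                                      (λ (v , eq , x↝v) → v , eq , ↝-trans (↝-sym x↝y) x↝v)
                                      (λ (v , eq , y↝v) → v , eq , ↝-trans x↝y y↝v) ⟩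
    value (rep-search y)         ≡⟨ proj₁ (proj₂ (holds (rep-search y))) ⟨
    toℕ (rep y)                  ∎)

  ↝⇔rep≡ : ∀ x y → x ↝ y ⇔ rep x ≡ rep y
  ↝⇔rep≡ x y = mk⇔ rep-cong
    λ eq → ↝-trans (↝-rep x) (subst (_↝ y) (sym eq) (↝-sym (↝-rep y)))

  rep-iter : ∀ t x → rep (iter φ t x) ≡ rep x
  rep-iter t x = sym (rep-cong (iter-↝ t x))

  rep-idem : ∀ x → rep (rep x) ≡ rep x
  rep-idem x = sym (rep-cong (↝-rep x))

  period-rep : ∀ x → period (rep x) ≡ period x
  period-rep x = trans (cong period (sym (proj₂ (↝-rep x)))) (period-iter (proj₁ (↝-rep x)) x)

  IndexOf : Fin n → Pred ℕ 0ℓ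
  IndexOf x j = iter φ j (rep x) ≡ x

  abstract
    index-search : (x : Fin n) → Least (IndexOf x)
    index-search x = least (λ j → iter φ j (rep x) ≟ x) {proj₁ rep↝x} (proj₂ rep↝x)
      where
      rep↝x : rep x ↝ x
      rep↝x = ↝-sym (↝-rep x)

  index : Fin n → ℕ
  index x = value (index-search x)

  iter-index : ∀ x → iter φ (index x) (rep x) ≡ x
  iter-index x = holds (index-search x)

  index<period : ∀ x → index x < period x
  index<period x = ≤-<-trans
    (least-≤ (index-search x) (trans (iter-mod-period (index x) (rep x)) (iter-index x)))
    (subst (index x % period (rep x) <_) (period-rep x) (m%n<n (index x) (period (rep x))))

  index-iter : ∀ t x → index (iter φ t x) ≡ (index x + t) % period x
  index-iter t x = iter-<period-injective (rep x)
    (subst (index y <_) (trans (period-iter t x) (sym (period-rep x))) (index<period y))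
    (subst ((index x + t) % period x <_) (sym (period-rep x)) (m%n<n (index x + t) (period x)))
    (begin
      iter φ (index y) (rep x)                   ≡⟨ cong (iter φ (index y)) (rep-iter t x) ⟨
      iter φ (index y) (rep y)                   ≡⟨ iter-index y ⟩
      iter φ t x                                 ≡⟨ cong (iter φ t) (iter-index x) ⟨
      iter φ t (iter φ (index x) (rep x))        ≡⟨ iter-+ t (index x) (rep x) ⟨
      iter φ (t + index x) (rep x)               ≡⟨ cong (λ c → iter φ c (rep x)) (+-comm t (index x)) ⟩
      iter φ (index x + t) (rep x)               ≡⟨ iter-mod-period (index x + t) (rep x) ⟨
      iter φ ((index x + t) % period (rep x)) (rep x) ≡⟨ cong (λ c → iter φ c (rep x)) (%-congʳ {o = index x + t} (period-rep x)) ⟩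
      iter φ ((index x + t) % period x) (rep x)  ∎)
    where
    y : Fin n
    y = iter φ t x

  rep-index-injective : ∀ {x y} → rep x ≡ rep y → index x ≡ index y → x ≡ y
  rep-index-injective {x} {y} r≡ i≡ =
    trans (sym (iter-index x)) (trans (cong₂ (iter φ) i≡ r≡) (iter-index y))

  at : Fin n → ℕ → Fin n
  at x j = iter φ j (rep x)

  rep-at : ∀ x j → rep (at x j) ≡ rep x
  rep-at x j = trans (rep-iter j (rep x)) (rep-idem x)

  index-at : ∀ x {j} → j < period x → index (at x j) ≡ j
  index-at x {j} j<L = begin
    index (at x j)                         ≡⟨ index-iter j (rep x) ⟩
    (index (rep x) + j) % period (rep x)   ≡⟨ cong (λ i → (i + j) % period (rep x)) index-rep ⟩
    j % period (rep x)                     ≡⟨ m<n⇒m%n≡m (subst (j <_) (sym (period-rep x)) j<L) ⟩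
    j                                      ∎
    where
    index-rep : index (rep x) ≡ 0
    index-rep = n≤0⇒n≡0 (least-≤ (index-search (rep x)) (rep-idem x))

-- A window of 2s consecutive positions, starting in block q of a cycle of length L cut into
-- blocks of length s, meets only blocks q, q+1 and (after wrapping around) 0, together with
-- block q+2 if it exists and block 1 otherwise.
blockCandidate : (s L q : ℕ) → Fin 4 → ℕ
blockCandidate s L q 0F = q
blockCandidate s L q 1F = suc q
blockCandidate s L q 2F = 0
blockCandidate s L q 3F = if does (suc (suc q) * s <? L) then suc (suc q) else 1

private
  between-q-and-3+q : ∀ {q b} → q ≤ b → b < 3 + q → b ≡ q ⊎ b ≡ suc q ⊎ b ≡ suc (suc q)
  between-q-and-3+q {zero}  {0}             _         _  = inj₁ refl
  between-q-and-3+q {zero}  {1}             _         _  = inj₂ (inj₁ refl)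
  between-q-and-3+q {zero}  {2}             _         _  = inj₂ (inj₂ refl)
  between-q-and-3+q {zero}  {suc (suc (suc _))} _ (s≤s (s≤s (s≤s ())))
  between-q-and-3+q {suc q} {suc b} (s≤s q≤b) (s≤s b<3+q) with between-q-and-3+q q≤b b<3+q
  ... | inj₁ b≡q          = inj₁ (cong suc b≡q)
  ... | inj₂ (inj₁ b≡1+q) = inj₂ (inj₁ (cong suc b≡1+q))
  ... | inj₂ (inj₂ b≡2+q) = inj₂ (inj₂ (cong suc b≡2+q))

  below-2 : ∀ {b} → b < 2 → b ≡ 0 ⊎ b ≡ 1
  below-2 {0} _ = inj₁ refl
  below-2 {1} _ = inj₂ refl
  below-2 {suc (suc _)} (s≤s (s≤s ()))

shifted-block-candidate : ∀ s L a t .{{_ : NonZero s}} .{{_ : NonZero L}} → a < L → t < 2 * s →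
                          ∃[ c ] (a + t) % L / s ≡ blockCandidate s L (a / s) c
shifted-block-candidate s L a t a<L t<2s = by-wraps ((a + t) / L) (m≡m%n+[m/n]*n (a + t) L)
  where
  open ≤-Reasoning
  q p b : ℕ
  q = a / s
  p = (a + t) % L
  b = p / s

  candidate-3 : suc (suc q) * s < L → blockCandidate s L q 3F ≡ suc (suc q)
  candidate-3 lt = cong (if_then suc (suc q) else 1) (dec-true (suc (suc q) * s <? L) lt)

  candidate-1 : ¬ suc (suc q) * s < L → blockCandidate s L q 3F ≡ 1
  candidate-1 ¬lt = cong (if_then suc (suc q) else 1) (dec-false (suc (suc q) * s <? L) ¬lt)

  qs≤a : q * s ≤ a
  qs≤a = m/n*n≤m a s

  window-end : a + t < suc (suc (suc q)) * s
  window-end = begin-strict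
    a + t                  <⟨ +-mono-< a<[1+q]s t<2s ⟩
    (s + q * s) + 2 * s    ≡⟨ regroup s (q * s) ⟩
    suc (suc (suc q)) * s  ∎
    where
    a<[1+q]s : a < s + q * s
    a<[1+q]s = begin-strict
      a               ≡⟨ m≡m%n+[m/n]*n a s ⟩
      a % s + q * s   <⟨ +-monoˡ-< (q * s) (m%n<n a s) ⟩
      s + q * s       ∎
    regroup : ∀ s qs → (s + qs) + 2 * s ≡ s + (s + (s + qs))
    regroup = solve-∀

  bs≤p : b * s ≤ p
  bs≤p = m/n*n≤m p s

  unwrapped : p ≡ a + t → ∃[ c ] b ≡ blockCandidate s L q c
  unwrapped p≡a+t with between-q-and-3+q q≤b b<3+q
    where
    q≤b : q ≤ b
    q≤b = subst (_≤ b) (m*n/n≡m q s) (/-monoˡ-≤ s (≤-trans qs≤a (≤-trans (m≤m+n a t) (≤-reflexive (sym p≡a+t)))))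
    b<3+q : b < 3 + q
    b<3+q = m<n*o⇒m/o<n (subst (_< suc (suc (suc q)) * s) (sym p≡a+t) window-end)
  ... | inj₁ b≡q          = 0F , b≡q
  ... | inj₂ (inj₁ b≡1+q) = 1F , b≡1+q
  ... | inj₂ (inj₂ b≡2+q) = 3F , trans b≡2+q (sym (candidate-3 (begin-strict
    suc (suc q) * s  ≡⟨ cong (_* s) b≡2+q ⟨
    b * s            ≤⟨ bs≤p ⟩
    p                <⟨ m%n<n (a + t) L ⟩
    L                ∎)))

  wrapped : p + L ≤ a + t → ∃[ c ] b ≡ blockCandidate s L q c
  wrapped p+L≤a+t with below-2 b<2
    where
    b<2 : b < 2
    b<2 = m<n*o⇒m/o<n (+-cancelˡ-< L p (2 * s) (begin-strict
      L + p  ≡⟨ +-comm L p ⟩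
      p + L  ≤⟨ p+L≤a+t ⟩
      a + t  <⟨ +-mono-< a<L t<2s ⟩
      L + 2 * s ∎))
  ... | inj₁ b≡0 = 2F , b≡0
  ... | inj₂ b≡1 = 3F , trans b≡1 (sym (candidate-1 λ q+2<L → <-irrefl refl (begin-strict
    suc (suc (suc q)) * s  <⟨ +-monoʳ-< s q+2<L ⟩
    s + L                  ≤⟨ +-monoˡ-≤ L s≤p ⟩
    p + L                  ≤⟨ p+L≤a+t ⟩
    a + t                  <⟨ window-end ⟩
    suc (suc (suc q)) * s  ∎)))
    where
    s≤p : s ≤ p
    s≤p = subst (_≤ p) (trans (cong (_* s) b≡1) (*-identityˡ s)) bs≤p

  by-wraps : ∀ m → a + t ≡ p + m * L → ∃[ c ] b ≡ blockCandidate s L q c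
  by-wraps zero    a+t≡p+0    = unwrapped (sym (trans a+t≡p+0 (+-identityʳ p)))
  by-wraps (suc m) a+t≡p+L+mL =
    wrapped (≤-trans (+-monoʳ-≤ p (m≤m+n L (m * L))) (≤-reflexive (sym a+t≡p+L+mL)))

-- Colours of a quotient

T-implication : ∀ {x y z} → T (not x ∨ not y ∨ z) ⇔ (T x → T y → T z)
T-implication {false}         = mk⇔ (λ _ ()) _
T-implication {true} {false}  = mk⇔ (λ _ _ ()) _
T-implication {true} {true}   = mk⇔ (λ z _ _ → z) (λ f → f _ _)

¬T-implication : ∀ {x y z} → ¬ T (not x ∨ not y ∨ z) → T x × T y × ¬ T z
¬T-implication {false}        ¬t = contradiction _ ¬t
¬T-implication {true} {false} ¬t = contradiction _ ¬t
¬T-implication {true} {true}  ¬t = _ , _ , ¬t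

T-all-allFin : ∀ {n} (p : Fin n → Bool) → T (all p (allFin n)) ⇔ (∀ i → T (p i))
T-all-allFin {n} p = mk⇔ (λ t i → All.lookup (all⁺ p (allFin n) t) (∈-allFin i))
                          (λ t → all⁻ p (tabulate⁺ t))

T-any-allFin : ∀ {n} (p : Fin n → Bool) → T (any p (allFin n)) ⇔ (∃[ i ] T (p i))
T-any-allFin {n} p = mk⇔ (Any.satisfied ∘ any⁻ p (allFin n))
                          (λ (i , t) → any⁺ p (lose (∈-allFin i) t))

T-==f : ∀ {n} {a b : Fin n} → T (a ==f b) ⇔ a ≡ b
T-==f = mk⇔ toWitness fromWitness

T-==c : ∀ {c d} → T (c ==c d) ⇔ c ≡ d
T-==c {none}  {none}  = mk⇔ (λ _ → refl) _
T-==c {black} {black} = mk⇔ (λ _ → refl) _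
T-==c {red}   {red}   = mk⇔ (λ _ → refl) _
T-==c {none}  {black} = mk⇔ (λ ()) (λ ())
T-==c {none}  {red}   = mk⇔ (λ ()) (λ ())
T-==c {black} {none}  = mk⇔ (λ ()) (λ ())
T-==c {black} {red}   = mk⇔ (λ ()) (λ ())
T-==c {red}   {none}  = mk⇔ (λ ()) (λ ())
T-==c {red}   {black} = mk⇔ (λ ()) (λ ())

T-injective : ∀ {x y} → T x ⇔ T y → x ≡ y
T-injective x⇔y = ⇔→≡ (⇔.trans (⇔.sym T-≡) (⇔.trans x⇔y T-≡))

==f-≢ : ∀ {n} {a b : Fin n} → a ≢ b → (a ==f b) ≡ false
==f-≢ {a = a} {b} a≢b with a ≟ b
... | yes a≡b = contradiction a≡b a≢b
... | no _    = refl

T-inImage : ∀ {n} (P : Labeling n) {b} → T (inImage P b) ⇔ (∃[ x ] P x ≡ b)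
T-inImage P = ⇔.trans (T-any-allFin _) (mk⇔ (λ (x , t) → x , to T-==f t) (λ (x , e) → x , from T-==f e))

Unique-lookup-injective : ∀ {A : Set} {xs : List A} → Unique xs → ∀ {i j} → lookup xs i ≡ lookup xs j → i ≡ j
Unique-lookup-injective (x∉xs ∷ _) {zero}  {zero}  _ = refl
Unique-lookup-injective (x∉xs ∷ _) {zero}  {suc j} e = contradiction e (All.lookup x∉xs (∈-lookup j))
Unique-lookup-injective (x∉xs ∷ _) {suc i} {zero}  e = contradiction (sym e) (All.lookup x∉xs (∈-lookup i))
Unique-lookup-injective (_ ∷ u)    {suc i} {suc j} e = cong suc (Unique-lookup-injective u e)

length-unique-⊆ : ∀ {A : Set} {xs ys : List A} → Unique xs → (∀ {x} → x ∈ xs → x ∈ ys) → length xs ≤ length ys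
length-unique-⊆ {xs = xs} {ys} u xs⊆ys = injective⇒≤ position-injective
  where
  position : Fin (length xs) → Fin (length ys)
  position i = Any.index (xs⊆ys (∈-lookup i))
  position-injective : ∀ {i j} → position i ≡ position j → i ≡ j
  position-injective {i} {j} e = Unique-lookup-injective u (begin
    lookup xs i                ≡⟨ lookup-index (xs⊆ys (∈-lookup i)) ⟩
    lookup ys (position i)     ≡⟨ cong (lookup ys) e ⟩
    lookup ys (position j)     ≡⟨ lookup-index (xs⊆ys (∈-lookup j)) ⟨
    lookup xs j                ∎)
    where
    open ≡-Reasoning

length-filterᵇ-allFin : ∀ {n} (p : Fin n → Bool) {ys} → (∀ {i} → T (p i) → i ∈ ys) →
                        length (filterᵇ p (allFin n)) ≤ length ys
length-filterᵇ-allFin {n} p p⇒∈ =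
  length-unique-⊆ (filter⁺ (T? ∘ p) (allFin⁺ n)) (p⇒∈ ∘ proj₂ ∘ ∈-filter⁻ (T? ∘ p) {xs = allFin n})

Uniform : ∀ {n} → Trigraph n → Labeling n → Fin n → Fin n → Color → Set
Uniform {n} G P a b c = ∀ (u w : Fin n) → P u ≡ a → P w ≡ b → G u w ≡ c

uniformᵇ : ∀ {n} → Trigraph n → Labeling n → Fin n → Fin n → Color → Bool
uniformᵇ {n} G P a b c =
  all (λ u → all (λ w → not (P u ==f a) ∨ not (P w ==f b) ∨ (G u w ==c c)) (allFin n)) (allFin n)

T-uniformᵇ : ∀ {n} (G : Trigraph n) P a b c → T (uniformᵇ G P a b c) ⇔ Uniform G P a b c
T-uniformᵇ G P a b c = mk⇔
  (λ t u w Pu≡a Pw≡b → to T-==c (to T-implication (to (T-all-allFin _) (to (T-all-allFin _) t u) w)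
                                                    (from T-==f Pu≡a) (from T-==f Pw≡b)))
  (λ uniform → from (T-all-allFin _) λ u → from (T-all-allFin _) λ w → from T-implication
     λ tu tw → from T-==c (uniform u w (to T-==f tu) (to T-==f tw)))

colourOf : (same allBlack allNone : Bool) → Color
colourOf same allBlack allNone = if same then none else (if allBlack then black else (if allNone then none else red))

colourOf≡black : ∀ {x y} → colourOf false x y ≡ black ⇔ T x
colourOf≡black {true}          = mk⇔ _ (λ _ → refl)
colourOf≡black {false} {true}  = mk⇔ (λ ()) (λ ())
colourOf≡black {false} {false} = mk⇔ (λ ()) (λ ())

colourOf≡none : ∀ {x y} → (T x → ¬ T y) → colourOf false x y ≡ none ⇔ T y
colourOf≡none {true}          x⇒¬y = mk⇔ (λ ()) (λ t → contradiction t (x⇒¬y _))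
colourOf≡none {false} {true}  _    = mk⇔ _ (λ _ → refl)
colourOf≡none {false} {false} _    = mk⇔ (λ ()) (λ ())

colourOf≡red : ∀ {s x y} → colourOf s x y ≡ red → ¬ T y
colourOf≡red {true}  ()
colourOf≡red {false} {true} ()
colourOf≡red {false} {false} {true} ()
colourOf≡red {false} {false} {false} _ ()

module _ {n} (G : Trigraph n) (P : Labeling n) {a b : Fin n} where

  quotColor-≢ : a ≢ b → quotColor G P a b ≡ colourOf false (uniformᵇ G P a b black) (uniformᵇ G P a b none)
  quotColor-≢ a≢b = cong (λ s → colourOf s (uniformᵇ G P a b black) (uniformᵇ G P a b none)) (==f-≢ a≢b)

  quotColor≡black⇔ : a ≢ b → quotColor G P a b ≡ black ⇔ Uniform G P a b black
  quotColor≡black⇔ a≢b rewrite quotColor-≢ a≢b = ⇔.trans colourOf≡black (T-uniformᵇ G P a b black)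

  quotColor≡none⇔ : a ≢ b → (∃[ u ] P u ≡ a) → (∃[ w ] P w ≡ b) →
                    quotColor G P a b ≡ none ⇔ Uniform G P a b none
  quotColor≡none⇔ a≢b (u , Pu≡a) (w , Pw≡b) rewrite quotColor-≢ a≢b =
    ⇔.trans (colourOf≡none black⇒¬none) (T-uniformᵇ G P a b none)
    where
    black⇒¬none : T (uniformᵇ G P a b black) → ¬ T (uniformᵇ G P a b none)
    black⇒¬none allBlack allNone with trans (sym (to (T-uniformᵇ G P a b black) allBlack u w Pu≡a Pw≡b))
                                             (to (T-uniformᵇ G P a b none) allNone u w Pu≡a Pw≡b)
    ... | ()

  quotColor≡red⇒adjacent : quotColor G P a b ≡ red → ∃[ u ] ∃[ w ] P u ≡ a × P w ≡ b × Adj G u w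
  quotColor≡red⇒adjacent isRed with ¬∀⟶∃¬ n _ (λ u → T? _) ¬uniform
    where
    ¬uniform : ¬ (∀ u → T (all (λ w → not (P u ==f a) ∨ not (P w ==f b) ∨ (G u w ==c none)) (allFin n)))
    ¬uniform = colourOf≡red {a ==f b} {uniformᵇ G P a b black} isRed ∘ from (T-all-allFin _)
  ... | u , ¬uniform-u with ¬∀⟶∃¬ n _ (λ w → T? _) (¬uniform-u ∘ from (T-all-allFin _))
  ...   | w , ¬uniform-uw with ¬T-implication ¬uniform-uw
  ...     | Pu≡a , Pw≡b , ¬none = u , w , to T-==f Pu≡a , to T-==f Pw≡b , ¬none ∘ from T-==c

redDeg≤ : ∀ {n} (G : Trigraph n) (P : Labeling n) a {ys} →
          (∀ {b} → (∃[ x ] P x ≡ b) → quotColor G P a b ≡ red → b ∈ ys) → redDeg G P a ≤ length ys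
redDeg≤ G P a red⇒∈ = length-filterᵇ-allFin _ λ t →
  red⇒∈ (to (T-inImage P) (proj₁ (to T-∧ t))) (to T-==c (proj₂ (to T-∧ t)))

deg≤Δ : ∀ {n} (G : Trigraph n) x → deg G x ≤ Δ G
deg≤Δ {n} G x = go (allFin n) (∈-allFin x)
  where
  go : ∀ xs → x ∈ xs → deg G x ≤ foldr _⊔_ 0 (map (deg G) xs)
  go (y ∷ ys) (here refl) = m≤m⊔n _ _
  go (y ∷ ys) (there x∈ys) = ≤-trans (go ys x∈ys) (m≤n⊔m _ _)

-- Dyadic blocks

-- Instance search cannot find NonZero (2 ^ k) for a variable k by itself.
module Power2 (k : ℕ) where
  instance
    2^k≢0 : NonZero (2 ^ k)
    2^k≢0 = m^n≢0 2 k
    2^[1+k]≢0 : NonZero (2 ^ suc k)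
    2^[1+k]≢0 = m^n≢0 2 (suc k)
    2^k*2≢0 : NonZero (2 ^ k * 2)
    2^k*2≢0 = m*n≢0 (2 ^ k) 2

  m/2^[1+k]≡m/2^k/2 : ∀ m → m / 2 ^ suc k ≡ m / 2 ^ k / 2
  m/2^[1+k]≡m/2^k/2 m = trans (/-congʳ (*-comm 2 (2 ^ k))) (sym (m/n/o≡m/[n*o] m (2 ^ k) 2))

n<2^n : ∀ n → n < 2 ^ n
n<2^n zero    = s≤s z≤n
n<2^n (suc n) = +-mono-≤-< (m^n>0 2 n) (subst (suc n ≤_) (sym (+-identityʳ (2 ^ n))) (n<2^n n))

_⊑_ : ∀ {n} {A B : Set} → (Fin n → A) → (Fin n → B) → Set
f ⊑ g = ∀ x y → f x ≡ f y → g x ≡ g y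

length-cartesianProductWith : ∀ {A B C : Set} (f : A → B → C) xs ys →
                              length (cartesianProductWith f xs ys) ≡ length xs * length ys
length-cartesianProductWith f []       ys = refl
length-cartesianProductWith f (x ∷ xs) ys = begin
  length (map (f x) ys ++ cartesianProductWith f xs ys)        ≡⟨ length-++ (map (f x) ys) ⟩
  length (map (f x) ys) + length (cartesianProductWith f xs ys) ≡⟨ cong₂ _+_ (length-map (f x) ys) (length-cartesianProductWith f xs ys) ⟩
  length ys + length xs * length ys                            ∎
  where
  open ≡-Reasoning

module Blocks {n} (φ : Permutation′ n) where
  open Iterates φ

  block : ℕ → Fin n → Fin n × ℕ
  block k x = rep x , index x / 2 ^ k
    where
    open Power2 k

  block-suc : ∀ k {x y} → block k x ≡ block k y → block (suc k) x ≡ block (suc k) y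
  block-suc k {x} {y} same = cong₂ _,_ (,-injectiveˡ same) (begin
    index x / 2 ^ suc k   ≡⟨ m/2^[1+k]≡m/2^k/2 (index x) ⟩
    index x / 2 ^ k / 2   ≡⟨ cong (_/ 2) (,-injectiveʳ same) ⟩
    index y / 2 ^ k / 2   ≡⟨ m/2^[1+k]≡m/2^k/2 (index y) ⟨
    index y / 2 ^ suc k   ∎)
    where
    open ≡-Reasoning
    open Power2 k

  block-0-injective : ∀ {x y} → block 0 x ≡ block 0 y → x ≡ y
  block-0-injective {x} {y} same = rep-index-injective (,-injectiveˡ same)
    (trans (sym (n/1≡n (index x))) (trans (,-injectiveʳ same) (n/1≡n (index y))))

  block-n≡⇔↝ : ∀ x y → block n x ≡ block n y ⇔ x ↝ y
  block-n≡⇔↝ x y = mk⇔ (from (↝⇔rep≡ x y) ∘ ,-injectiveˡ)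
    λ x↝y → cong₂ _,_ (to (↝⇔rep≡ x y) x↝y) (trans (index/2^n≡0 x) (sym (index/2^n≡0 y)))
    where
    open Power2 n
    index/2^n≡0 : ∀ x → index x / 2 ^ n ≡ 0
    index/2^n≡0 x = m<n⇒m/n≡0 (<-≤-trans (index<period x) (≤-trans (period≤n x) (<⇒≤ (n<2^n n))))

  blockStart : ℕ → Fin n → Fin n
  blockStart k x = at x (index x / 2 ^ k * 2 ^ k)
    where
    open Power2 k

  block-members : ∀ k {u x} → block k u ≡ block k x → ∃[ t ] t < 2 ^ k × iter φ t (blockStart k x) ≡ u
  block-members k {u} {x} same = index u ∸ B , offset<2^k , (begin
    iter φ (index u ∸ B) (iter φ B (rep x))   ≡⟨ iter-+ (index u ∸ B) B (rep x) ⟨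
    iter φ (index u ∸ B + B) (rep x)          ≡⟨ cong₂ (iter φ) (m∸n+n≡m B≤index) (sym (,-injectiveˡ same)) ⟩
    iter φ (index u) (rep u)                  ≡⟨ iter-index u ⟩
    u                                         ∎)
    where
    open ≡-Reasoning
    open Power2 k
    B : ℕ
    B = index x / 2 ^ k * 2 ^ k
    B≡ : index u / 2 ^ k * 2 ^ k ≡ B
    B≡ = cong (_* 2 ^ k) (,-injectiveʳ same)
    B≤index : B ≤ index u
    B≤index = subst (_≤ index u) B≡ (m/n*n≤m (index u) (2 ^ k))
    offset<2^k : index u ∸ B < 2 ^ k
    offset<2^k = subst (_< 2 ^ k) (trans (m%n≡m∸m/n*n (index u) (2 ^ k)) (cong (index u ∸_) B≡))
                       (m%n<n (index u) (2 ^ k))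

  corner : ℕ → Fin n → Fin 4 → Fin n
  corner k w c = at w (blockCandidate (2 ^ k) (period w) (index w / 2 ^ k) c * 2 ^ k)
    where
    open Power2 k

  window-cover : ∀ k w {t} → t < 2 ^ suc k → ∃[ c ] block k (iter φ t w) ≡ block k (corner k w c)
  window-cover k w {t} t<2s = cover (shifted-block-candidate s (period w) (index w) t (index<period w) t<2s)
    where
    open Power2 k
    s : ℕ
    s = 2 ^ k
    cover : ∃[ c ] (index w + t) % period w / s ≡ blockCandidate s (period w) (index w / s) c →
            ∃[ c ] block k (iter φ t w) ≡ block k (corner k w c)
    cover (c , b≡candidate) = c , cong₂ _,_ (trans (rep-iter t w) (sym (rep-at w j))) (begin
      index (iter φ t w) / s                ≡⟨ cong (_/ s) (index-iter t w) ⟩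
      (index w + t) % period w / s          ≡⟨ b≡candidate ⟩
      candidate                             ≡⟨ m*n/n≡m candidate s ⟨
      j / s                                 ≡⟨ cong (_/ s) (index-at w j<period) ⟨
      index (at w j) / s                    ∎)
      where
      open ≡-Reasoning
      candidate j : ℕ
      candidate = blockCandidate s (period w) (index w / s) c
      j = candidate * s
      j<period : j < period w
      j<period = ≤-<-trans (subst (λ b → b * s ≤ (index w + t) % period w) b≡candidate
                                  (m/n*n≤m ((index w + t) % period w) s))
                           (m%n<n (index w + t) (period w))

  module _ (G : Trigraph n) (aut : IsAut G φ) where

    Adj-iter⁻ : ∀ t {a b} → Adj G (iter φ t a) (iter φ t b) → Adj G a b
    Adj-iter⁻ zero    adj = adj
    Adj-iter⁻ (suc t) adj = Adj-iter⁻ t (from (aut (iter φ t _) (iter φ t _)) adj)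

    neighbours : Fin n → List (Fin n)
    neighbours x = filterᵇ (λ y → not (G x y ==c none)) (allFin n)

    Adj⇒∈neighbours : ∀ {x y} → Adj G x y → y ∈ neighbours x
    Adj⇒∈neighbours {x} {y} adj = ∈-filter⁺ (T? ∘ λ y → not (G x y ==c none)) (∈-allFin y) (edge adj)
      where
      edge : ∀ {c} → c ≢ none → T (not (c ==c none))
      edge {none}  c≢none = contradiction refl c≢none
      edge {black} _      = _
      edge {red}   _      = _

    sandwich : ∀ k (P : Labeling n) → block k ⊑ P → P ⊑ block (suc k) → RedDegAtMost (4 * Δ G) G P
    sandwich k P fine coarse x = begin
      redDeg G P (P x)                    ≤⟨ redDeg≤ G P (P x) red⇒candidate ⟩
      length candidates                   ≡⟨ length-cartesianProductWith _ (neighbours b₀) (allFin 4) ⟩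
      deg G b₀ * 4                        ≤⟨ *-monoˡ-≤ 4 (deg≤Δ G b₀) ⟩
      Δ G * 4                             ≡⟨ *-comm (Δ G) 4 ⟩
      4 * Δ G                             ∎
      where
      open ≤-Reasoning
      b₀ : Fin n
      b₀ = blockStart (suc k) x
      candidates : List (Fin n)
      candidates = cartesianProductWith (λ w c → P (corner k w c)) (neighbours b₀) (allFin 4)
      red⇒candidate : ∀ {b} → (∃[ y ] P y ≡ b) → quotColor G P (P x) b ≡ red → b ∈ candidates
      red⇒candidate _ isRed =
        let (u , w , Pu≡Px , Pw≡b , u~w) = quotColor≡red⇒adjacent G P isRed
            (t , t<2s , b₀↦u) = block-members (suc k) (coarse u x Pu≡Px)
            (c , same-block) = window-cover k (iterˡ t w) t<2s
            b₀~w′ = Adj-iter⁻ t (subst₂ (Adj G) (sym b₀↦u) (sym (iter-iterˡ t w)) u~w)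
        in subst (_∈ candidates) (trans (sym (fine _ _ same-block)) (trans (cong P (iter-iterˡ t w)) Pw≡b))
                 (∈-cartesianProductWith⁺ (λ w c → P (corner k w c)) (Adj⇒∈neighbours b₀~w′) (∈-allFin c))

-- Merging parts

SameKernel : ∀ {n} {A B : Set} → (Fin n → A) → (Fin n → B) → Set
SameKernel {n} f g = ∀ (x y : Fin n) → f x ≡ f y ⇔ g x ≡ g y

⊑-trans : ∀ {n} {A B C : Set} {f : Fin n → A} {g : Fin n → B} {h : Fin n → C} → f ⊑ g → g ⊑ h → f ⊑ h
⊑-trans f⊑g g⊑h x y = g⊑h x y ∘ f⊑g x y

relabel : ∀ {n} → Fin n → Fin n → Fin n → Fin n
relabel a b c with c ≟ a
... | yes _ = b
... | no  _ = c

relabel≡relabel⇔ : ∀ {n} {a b : Fin n} → a ≢ b → ∀ c d →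
                   relabel a b c ≡ relabel a b d ⇔ (c ≡ d ⊎ (c ≡ a × d ≡ b) ⊎ (c ≡ b × d ≡ a))
relabel≡relabel⇔ {a = a} {b} a≢b c d with c ≟ a | d ≟ a
... | yes c≡a | yes d≡a = mk⇔ (λ _ → inj₁ (trans c≡a (sym d≡a))) (λ _ → refl)
... | yes c≡a | no  d≢a = mk⇔ (λ b≡d → inj₂ (inj₁ (c≡a , sym b≡d))) λ where
  (inj₁ c≡d)              → contradiction (trans (sym c≡d) c≡a) d≢a
  (inj₂ (inj₁ (_ , d≡b))) → sym d≡b
  (inj₂ (inj₂ (c≡b , _))) → contradiction (trans (sym c≡a) c≡b) a≢b
... | no  c≢a | yes d≡a = mk⇔ (λ c≡b → inj₂ (inj₂ (c≡b , d≡a))) λ where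
  (inj₁ c≡d)              → contradiction (trans c≡d d≡a) c≢a
  (inj₂ (inj₁ (c≡a , _))) → contradiction c≡a c≢a
  (inj₂ (inj₂ (c≡b , _))) → c≡b
... | no  c≢a | no  d≢a = mk⇔ inj₁ λ where
  (inj₁ c≡d)              → c≡d
  (inj₂ (inj₁ (c≡a , _))) → contradiction c≡a c≢a
  (inj₂ (inj₂ (_ , d≡a))) → contradiction d≡a d≢a

module _ {n} (P : Labeling n) {u v : Fin n} (Pu≢Pv : P u ≢ P v) where

  merge : Labeling n
  merge = relabel (P u) (P v) ∘ P

  merge-MergeStep : MergeStep P merge
  merge-MergeStep = u , v , Pu≢Pv , λ x y → relabel≡relabel⇔ Pu≢Pv (P x) (P y)

  ⊑-merge : P ⊑ merge
  ⊑-merge x y = cong (relabel (P u) (P v))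

  merge-joins : merge u ≡ merge v
  merge-joins = from (relabel≡relabel⇔ Pu≢Pv (P u) (P v)) (inj₂ (inj₁ (refl , refl)))

  merge-⊑ : ∀ {B : Set} {F : Fin n → B} → P ⊑ F → F u ≡ F v → merge ⊑ F
  merge-⊑ {F = F} P⊑F Fu≡Fv x y same with to (relabel≡relabel⇔ Pu≢Pv (P x) (P y)) same
  ... | inj₁ Px≡Py                = P⊑F x y Px≡Py
  ... | inj₂ (inj₁ (Px≡Pu , Py≡Pv)) = trans (P⊑F x u Px≡Pu) (trans Fu≡Fv (P⊑F v y (sym Py≡Pv)))
  ... | inj₂ (inj₂ (Px≡Pv , Py≡Pu)) = trans (P⊑F x v Px≡Pv) (trans (sym Fu≡Fv) (P⊑F u y (sym Py≡Pu)))

module Coarsening {n} (G : Trigraph n) (width : ℕ) {A B : Set} (E : Fin n → A) (F : Fin n → B)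
                  (_≟F_ : DecidableEquality B)
                  (between⇒width : ∀ P → E ⊑ P → P ⊑ F → RedDegAtMost width G P) where

  record Between (P : Labeling n) : Set where
    field
      pcs    : PCS G width P
      fine   : E ⊑ P
      coarse : P ⊑ F

  open Between

  join : ∀ {P} x y → F x ≡ F y → Between P → Σ[ P′ ∈ Labeling n ] Between P′ × P ⊑ P′ × P′ x ≡ P′ y
  join {P} x y Fx≡Fy between with P x ≟ P y
  ... | yes Px≡Py = P , between , (λ _ _ same → same) , Px≡Py
  ... | no  Px≢Py = merge P Px≢Py , between′ , ⊑-merge P Px≢Py , merge-joins P Px≢Py
    where
    fine′ : E ⊑ merge P Px≢Py
    fine′ = ⊑-trans (fine between) (⊑-merge P Px≢Py)
    coarse′ : merge P Px≢Py ⊑ F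
    coarse′ = merge-⊑ P Px≢Py (coarse between) Fx≡Fy
    between′ : Between (merge P Px≢Py)
    between′ = record
      { pcs    = step (pcs between) (merge-MergeStep P Px≢Py) (between⇒width _ fine′ coarse′)
      ; fine   = fine′
      ; coarse = coarse′
      }

  joinAll : ∀ ps {P} → Between P →
            Σ[ P′ ∈ Labeling n ] Between P′ × P ⊑ P′ × (∀ {x y} → (x , y) ∈ ps → F x ≡ F y → P′ x ≡ P′ y)
  joinAll [] {P} between = P , between , (λ _ _ same → same) , λ ()
  joinAll ((x , y) ∷ ps) between with F x ≟F F y
  ... | no Fx≢Fy with joinAll ps between
  ...   | P′ , between′ , P⊑P′ , joined = P′ , between′ , P⊑P′ , λ where
    (here refl) Fx≡Fy → contradiction Fx≡Fy Fx≢Fy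
    (there xy∈ps)      → joined xy∈ps
  joinAll ((x , y) ∷ ps) between | yes Fx≡Fy with join x y Fx≡Fy between
  ...   | P₁ , between₁ , P⊑P₁ , P₁x≡P₁y with joinAll ps between₁
  ...     | P′ , between′ , P₁⊑P′ , joined = P′ , between′ , ⊑-trans P⊑P₁ P₁⊑P′ , λ where
    (here refl) _ → P₁⊑P′ x y P₁x≡P₁y
    (there xy∈ps)  → joined xy∈ps

  coarsen : ∀ {P} → Between P → Σ[ P′ ∈ Labeling n ] PCS G width P′ × SameKernel P′ F
  coarsen between with joinAll (cartesianProduct (allFin n) (allFin n)) between
  ... | P′ , between′ , _ , joined = P′ , pcs between′ , λ x y →
    mk⇔ (coarse between′ x y) (joined (∈-cartesianProduct⁺ (∈-allFin x) (∈-allFin y)))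

module OrbitContraction {n} (G : Trigraph n) (φ : Permutation′ n) (aut : IsAut G φ) where
  open Iterates φ
  open Blocks φ

  level : ∀ k → Σ[ P ∈ Labeling n ] PCS G (4 * Δ G) P × SameKernel P (block k)
  level zero = id , start (λ _ _ → id) (sandwich G aut 0 id (λ _ _ → block-0-injective) (λ _ _ → cong (block 1)))
             , λ _ _ → mk⇔ (cong (block 0)) block-0-injective
  level (suc k) with level k
  ... | P , pcs , P≈block = coarsen (record
        { pcs    = pcs
        ; fine   = λ x y → from (P≈block x y)
        ; coarse = λ x y → block-suc k ∘ to (P≈block x y)
        })
    where
    open Coarsening G (4 * Δ G) (block k) (block (suc k)) (≡-dec _≟_ _≟ℕ_) (sandwich G aut k)

  orbit-contraction : Σ[ P ∈ Labeling n ] PCS G (4 * Δ G) P × IsOrbitPartition φ P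
  orbit-contraction with level n
  ... | P , pcs , P≈block = P , pcs , λ x y → ⇔.trans (P≈block x y) (block-n≡⇔↝ x y)

-- Lifting contraction sequences from the quotient

RedDegAtMost-mono : ∀ {n} {k k′} {G : Trigraph n} {P} → k ≤ k′ → RedDegAtMost k G P → RedDegAtMost k′ G P
RedDegAtMost-mono k≤k′ bounded x = ≤-trans (bounded x) k≤k′

PCS-mono : ∀ {n} {k k′} {G : Trigraph n} {P} → k ≤ k′ → PCS G k P → PCS G k′ P
PCS-mono k≤k′ (start discrete bounded)  = start discrete (RedDegAtMost-mono k≤k′ bounded)
PCS-mono k≤k′ (step pcs merge bounded) = step (PCS-mono k≤k′ pcs) merge (RedDegAtMost-mono k≤k′ bounded)

PCS-retarget : ∀ {n} {k} {G : Trigraph n} {P T} → PCS G k P → SameKernel P T → RedDegAtMost k G T → PCS G k T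
PCS-retarget (start discrete _) P≈T bounded = start (λ x y → discrete x y ∘ from (P≈T x y)) bounded
PCS-retarget (step pcs (u , v , Pu≢Pv , merged) _) P≈T bounded =
  step pcs (u , v , Pu≢Pv , λ x y → ⇔.trans (⇔.sym (P≈T x y)) (merged x y)) bounded

quotColor-refl : ∀ {n} (G : Trigraph n) P a → quotColor G P a a ≡ none
quotColor-refl G P a = cong (λ s → colourOf s (uniformᵇ G P a a black) (uniformᵇ G P a a none))
                            (to T-≡ (from (T-==f {a = a}) refl))

module Lifting {n} (G : Trigraph n) (P : Labeling n) where

  m : ℕ
  m = numParts P

  Q : Trigraph m
  Q = quotient G P

  lab : Fin m → Fin n
  lab = lookup (partLabels P)

  lab-injective : ∀ {i j} → lab i ≡ lab j → i ≡ j
  lab-injective = Unique-lookup-injective (filter⁺ (T? ∘ inImage P) (allFin⁺ n))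

  P∈partLabels : ∀ x → P x ∈ partLabels P
  P∈partLabels x = ∈-filter⁺ (T? ∘ inImage P) (∈-allFin (P x)) (from (T-inImage P) (x , refl))

  part : Fin n → Fin m
  part x = Any.index (P∈partLabels x)

  lab-part : ∀ x → lab (part x) ≡ P x
  lab-part x = sym (lookup-index (P∈partLabels x))

  part-surjective : ∀ j → ∃[ x ] part x ≡ j
  part-surjective j with to (T-inImage P) (proj₂ (∈-filter⁻ (T? ∘ inImage P) {xs = allFin n} (∈-lookup j)))
  ... | x , Px≡lab-j = x , lab-injective (trans (lab-part x) Px≡lab-j)

  part-nonempty : ∀ j → ∃[ x ] P x ≡ lab j
  part-nonempty j with part-surjective j
  ... | x , refl = x , sym (lab-part x)

  lift : Labeling m → Labeling n
  lift R = lab ∘ R ∘ part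

  lab-cong⇔ : ∀ {i j} → i ≡ j ⇔ lab i ≡ lab j
  lab-cong⇔ = mk⇔ (cong lab) lab-injective

  Discrete⇒SameKernel : ∀ {R} → Discrete R → SameKernel P (lift R)
  Discrete⇒SameKernel {R} discrete x y = mk⇔
    (λ Px≡Py → cong (lab ∘ R) (lab-injective (trans (lab-part x) (trans Px≡Py (sym (lab-part y))))))
    (λ same → trans (sym (lab-part x)) (trans (cong lab (discrete _ _ (lab-injective same))) (lab-part y)))

  SinglePart-lift : ∀ {R} → SinglePart R → SinglePart (lift R)
  SinglePart-lift single x y = cong lab (single (part x) (part y))

  MergeStep-lift : ∀ {R R′} → MergeStep R R′ → MergeStep (lift R) (lift R′)
  MergeStep-lift {R} {R′} (u , v , Ru≢Rv , merged) with part-surjective u | part-surjective v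
  ... | xu , refl | xv , refl = xu , xv , Ru≢Rv ∘ lab-injective , λ x y →
    ⇔.trans (⇔.sym lab-cong⇔)
      (⇔.trans (merged (part x) (part y))
               (lab-cong⇔ ⊎-⇔ (lab-cong⇔ ×-⇔ lab-cong⇔) ⊎-⇔ (lab-cong⇔ ×-⇔ lab-cong⇔)))

  module _ (R : Labeling m) where

    Uniform-lift : ∀ {col} → (∀ {i j} → i ≢ j → Q i j ≡ col ⇔ Uniform G P (lab i) (lab j) col) →
                   ∀ {a c} → a ≢ c → Uniform G (lift R) (lab a) (lab c) col ⇔ Uniform Q R a c col
    Uniform-lift Q⇔ {a} {c} a≢c = mk⇔
      (λ uniform i j Ri≡a Rj≡c → from (Q⇔ (λ i≡j → a≢c (trans (sym Ri≡a) (trans (cong R i≡j) Rj≡c))))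
        λ u w Pu≡lab-i Pw≡lab-j → uniform u w (in-part u Pu≡lab-i Ri≡a) (in-part w Pw≡lab-j Rj≡c))
      (λ uniform u w lift-u≡ lift-w≡ →
        to (Q⇔ (λ pu≡pw → a≢c (trans (sym (lab-injective lift-u≡)) (trans (cong R pu≡pw) (lab-injective lift-w≡)))))
           (uniform (part u) (part w) (lab-injective lift-u≡) (lab-injective lift-w≡))
           u w (sym (lab-part u)) (sym (lab-part w)))
      where
      in-part : ∀ {i a} x → P x ≡ lab i → R i ≡ a → lift R x ≡ lab a
      in-part x Px≡lab-i Ri≡a =
        cong lab (trans (cong R (lab-injective (trans (lab-part x) Px≡lab-i))) Ri≡a)

    quotColor-lift-≢ : ∀ {a c} → a ≢ c → quotColor G (lift R) (lab a) (lab c) ≡ quotColor Q R a c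
    quotColor-lift-≢ {a} {c} a≢c = begin
      quotColor G (lift R) (lab a) (lab c)  ≡⟨ quotColor-≢ G (lift R) (a≢c ∘ lab-injective) ⟩
      colourOf false (uniformᵇ G (lift R) (lab a) (lab c) black) (uniformᵇ G (lift R) (lab a) (lab c) none)
        ≡⟨ cong₂ (colourOf false) (uniformᵇ-lift black-characterisation) (uniformᵇ-lift none-characterisation) ⟩
      colourOf false (uniformᵇ Q R a c black) (uniformᵇ Q R a c none)
        ≡⟨ quotColor-≢ Q R a≢c ⟨
      quotColor Q R a c                     ∎
      where
      open ≡-Reasoning
      black-characterisation : ∀ {i j} → i ≢ j → Q i j ≡ black ⇔ Uniform G P (lab i) (lab j) black
      black-characterisation i≢j = quotColor≡black⇔ G P (i≢j ∘ lab-injective)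
      none-characterisation : ∀ {i j} → i ≢ j → Q i j ≡ none ⇔ Uniform G P (lab i) (lab j) none
      none-characterisation {i} {j} i≢j =
        quotColor≡none⇔ G P (i≢j ∘ lab-injective) (part-nonempty i) (part-nonempty j)
      uniformᵇ-lift : ∀ {col} → (∀ {i j} → i ≢ j → Q i j ≡ col ⇔ Uniform G P (lab i) (lab j) col) →
                      uniformᵇ G (lift R) (lab a) (lab c) col ≡ uniformᵇ Q R a c col
      uniformᵇ-lift {col} Q⇔ = T-injective
        (⇔.trans (T-uniformᵇ G (lift R) (lab a) (lab c) col)
                 (⇔.trans (Uniform-lift Q⇔ a≢c) (⇔.sym (T-uniformᵇ Q R a c col))))

    quotColor-lift : ∀ a c → quotColor G (lift R) (lab a) (lab c) ≡ quotColor Q R a c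
    quotColor-lift a c = by-cases (a ≟ c)
      where
      by-cases : Dec (a ≡ c) → quotColor G (lift R) (lab a) (lab c) ≡ quotColor Q R a c
      by-cases (yes refl) = trans (quotColor-refl G (lift R) (lab a)) (sym (quotColor-refl Q R a))
      by-cases (no a≢c)   = quotColor-lift-≢ a≢c

    redDeg-lift : ∀ x → redDeg G (lift R) (lift R x) ≤ redDeg Q R (R (part x))
    redDeg-lift x = ≤-trans (redDeg≤ G (lift R) (lift R x) red⇒∈) (≤-reflexive (length-map lab redNeighbours))
      where
      redNeighbours : List (Fin m)
      redNeighbours = filterᵇ (λ c → inImage R c ∧ (quotColor Q R (R (part x)) c ==c red)) (allFin m)
      red⇒∈ : ∀ {b} → (∃[ y ] lift R y ≡ b) → quotColor G (lift R) (lift R x) b ≡ red → b ∈ map lab redNeighbours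
      red⇒∈ (y , refl) isRed = ∈-map⁺ lab (∈-filter⁺ (T? ∘ _) (∈-allFin (R (part y)))
        (from T-∧ (from (T-inImage R) (part y , refl) , from T-==c (trans (sym (quotColor-lift _ _)) isRed))))

    RedDegAtMost-lift : ∀ {t} → RedDegAtMost t Q R → RedDegAtMost t G (lift R)
    RedDegAtMost-lift bounded x = ≤-trans (redDeg-lift x) (bounded (part x))

  PCS-lift : ∀ {w t P₀ R} → PCS G w P₀ → SameKernel P₀ P → PCS Q t R → PCS G (w ⊔ t) (lift R)
  PCS-lift pcs₀ P₀≈P (start discrete bounded) =
    PCS-retarget (PCS-mono (m≤m⊔n _ _) pcs₀) (λ x y → ⇔.trans (P₀≈P x y) (Discrete⇒SameKernel discrete x y))
                 (RedDegAtMost-mono (m≤n⊔m _ _) (RedDegAtMost-lift _ bounded))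
  PCS-lift pcs₀ P₀≈P (step pcs merged bounded) =
    step (PCS-lift pcs₀ P₀≈P pcs) (MergeStep-lift merged) (RedDegAtMost-mono (m≤n⊔m _ _) (RedDegAtMost-lift _ bounded))

lemma3p5 : ∀ {n} (G : Trigraph n) → IsTrigraph G → (φ : Permutation′ n) → IsAut G φ →
    (Σ (Labeling n) λ P → PCS G (4 * Δ G) P × IsOrbitPartition φ P)
    × (∀ (P : Labeling n) → IsOrbitPartition φ P → ∀ (t : ℕ) →
         TwwAtMost (quotient G P) t → TwwAtMost G (4 * Δ G ⊔ t))
lemma3p5 G _ φ aut = orbit-contraction , quotient-tww
  where
  open OrbitContraction G φ aut
  quotient-tww : ∀ P → IsOrbitPartition φ P → ∀ t → TwwAtMost (quotient G P) t → TwwAtMost G (4 * Δ G ⊔ t)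
  quotient-tww P P-orbits t (R , pcs , single) with orbit-contraction
  ... | P₀ , pcs₀ , P₀-orbits =
    lift R , PCS-lift pcs₀ (λ x y → ⇔.trans (P₀-orbits x y) (⇔.sym (P-orbits x y))) pcs , SinglePart-lift single
    where
    open Lifting G P
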